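{- Every instance of scheduling with resource restrictions with $1$ resource is an instance of scheduling with interval restrictions, and there is an instance of scheduling with interval restrictions that is not an instance of scheduling with resource restrictions with $1$ resource. Moreover, every instance of scheduling with interval restrictions is an instance of scheduling with resource restrictions with $2$ resources, and there is an instance of scheduling with resource restrictions with $2$ resources that is not an instance of scheduling with interval restrictions.
   Context: All problems are restricted assignment problems: machines $\mathcal{M}$, jobs $\mathcal{J}$ with processing times and eligible machine sets $\mathcal{M}(j)\subseteq\mathcal{M}$. An instance is an instance of scheduling with interval restrictions if the machines can be totally ordered so that every $\mathcal{M}(j)$ consists of consecutive machines. It is an instance of scheduling with resource restrictions with $R$ resources if there exist $R$ resources, capacities $c_r(i)$ for machines and demands $d_r(j)$ for jobs (real numbers) such that $i\in\mathcal{M}(j)$ iff $d_r(j)\le c_r(i)$ for every resource $r$.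
   Formalization: The capacities $c_r(i)$ and demands $d_r(j)$ are rational rather than real, and the processing times are rational as well. -}

module Defs where

open import Data.Nat using (ℕ)
open import Data.Fin using (Fin; _≤_)
open import Data.Fin.Subset using (Subset; _∈_)
open import Data.Fin.Permutation using (Permutation′; _⟨$⟩ʳ_)
open import Data.Rational using (ℚ) renaming (_≤_ to _≤ℚ_)
open import Data.Product using (Σ; _×_)
open import Function.Bundles using (_⇔_)

record Instance : Set where
  field
    m   : ℕ
    n   : ℕ
    p   : Fin n → ℚ
    elig : Fin n → Subset m

open Instance public

-- Interval restrictions: there is a total order on the machines (given by a
-- permutation π: position ↦ machine) such that every M(j) consists of
-- consecutive machines w.r.t. that order.
IsIntervalInstance : Instance → Set
IsIntervalInstance I =
  Σ (Permutation′ (m I)) λ π →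
    ∀ (j : Fin (n I)) (a b c : Fin (m I)) → a ≤ b → b ≤ c →
      (π ⟨$⟩ʳ a) ∈ elig I j → (π ⟨$⟩ʳ c) ∈ elig I j → (π ⟨$⟩ʳ b) ∈ elig I j

IsResourceInstance : ℕ → Instance → Set
IsResourceInstance R I =
  Σ (Fin R → Fin (m I) → ℚ) λ c →
  Σ (Fin R → Fin (n I) → ℚ) λ d →
    ∀ (i : Fin (m I)) (j : Fin (n I)) →
      (i ∈ elig I j) ⇔ (∀ (r : Fin R) → d r j ≤ℚ c r i)

{-# OPTIONS --safe #-}
-- With one resource, listing the machines by increasing capacity turns every
-- eligible set into an upper set, hence an interval; moreover the eligible sets
-- form a chain, which fails for two jobs with two different private machines.
-- Conversely, an interval of positions [l, u] is cut out by two resources: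
-- the machine at position x gets capacities (x, -x) and the job demands (l, -u).
-- A star (a centre machine eligible for every job, plus one private leaf machine
-- per job) also has two resources, but with three leaves, in any order two
-- leaves lie on the same side of the centre; the nearer one then lies between
-- the centre and the farther one, so it belongs to the farther leaf's interval.
module Submission where

open import Defs
open import Data.Product using (Σ; _×_)
open import Relation.Nullary using (¬_)

open import Data.Product using (_,_; proj₁; proj₂)
open import Data.Sum using (_⊎_; inj₁; inj₂; [_,_]′)
import Data.Sum as Sum
open import Function using (_∘_)
open import Function.Bundles using (_⇔_; mk⇔; Equivalence)
open import Function.Construct.Composition using (_⇔-∘_)
open import Relation.Binary.Bundles using (TotalPreorder)
open import Relation.Binary.PropositionalEquality using (_≡_; _≢_; refl; sym; subst; subst₂)
open import Relation.Nullary using (yes; no; contradiction)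
open import Relation.Unary using (Decidable)
open import Data.Nat as ℕ using (ℕ; zero; suc; _+_; z≤n; s≤s)
import Data.Nat.Properties as ℕP
open import Data.Nat.Coprimality as Coprimality using (1-coprimeTo)
open import Data.Fin as F using (Fin; zero; suc; toℕ)
import Data.Fin.Properties as FP
open import Data.Fin.Subset using (Subset; _∈_; _⊆_; inside; ⁅_⁆)
open import Data.Fin.Subset.Properties using (_∈?_; drop-there; x∈⁅x⁆; x∈⁅y⁆⇒x≡y; x∈⁅y⁆⇔x≡y; x≢y⇒x∉⁅y⁆)
open import Data.Fin.Permutation as P using (Permutation′; _⟨$⟩ʳ_; _⟨$⟩ˡ_; _∘ₚ_; lift₀; transpose; inverseʳ)
open import Data.Integer as ℤ using (ℤ; +_; -_)
import Data.Integer.Properties as ℤP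
open import Data.Rational as Q using (ℚ; mkℚ; 1ℚ)
open import Data.Rational.Base using (*≤*)
import Data.Rational.Properties as QP
open import Data.Vec using (_∷_; here; there)

open Equivalence using (to; from)

fromℤ : ℤ → ℚ
fromℤ z = mkℚ z 0 (Coprimality.sym (1-coprimeTo _))

fromℤ-mono-≤ : ∀ {x y} → x ℤ.≤ y → fromℤ x Q.≤ fromℤ y
fromℤ-mono-≤ {x} {y} x≤y = *≤* (subst₂ ℤ._≤_ (sym (ℤP.*-identityʳ x)) (sym (ℤP.*-identityʳ y)) x≤y)

fromℤ-cancel-≤ : ∀ {x y} → fromℤ x Q.≤ fromℤ y → x ℤ.≤ y
fromℤ-cancel-≤ {x} {y} (*≤* x≤y) = subst₂ ℤ._≤_ (ℤP.*-identityʳ x) (ℤP.*-identityʳ y) x≤y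

module _ {a ℓ₁ ℓ₂} (O : TotalPreorder a ℓ₁ ℓ₂) where
  open TotalPreorder O using (_≲_; total) renaming (Carrier to A; refl to ≲-refl; trans to ≲-trans)

  minimumIndex : ∀ {m} (f : Fin (suc m) → A) → Σ (Fin (suc m)) λ i → ∀ k → f i ≲ f k
  minimumIndex {zero} f = zero , λ { zero → ≲-refl }
  minimumIndex {suc m} f with minimumIndex (f ∘ suc)
  ... | i , fi≲ with total (f zero) (f (suc i))
  ...   | inj₁ f0≲fi = zero , λ { zero → ≲-refl ; (suc k) → ≲-trans f0≲fi (fi≲ k) }
  ...   | inj₂ fi≲f0 = suc i , λ { zero → fi≲f0 ; (suc k) → fi≲ k }

  sortingPermutation : ∀ {m} (f : Fin m → A) → Σ (Permutation′ m) λ π →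
    ∀ {a b} → a F.≤ b → f (π ⟨$⟩ʳ a) ≲ f (π ⟨$⟩ʳ b)
  sortingPermutation {zero} f = P.id , λ { {()} }
  sortingPermutation {suc m} f with minimumIndex f
  ... | i₀ , fi₀≲ with sortingPermutation (λ k → f (transpose zero i₀ ⟨$⟩ʳ suc k))
  ...   | π , sorted = σ , monotone
    where
    σ : Permutation′ (suc m)
    σ = lift₀ π ∘ₚ transpose zero i₀
    monotone : ∀ {a b} → a F.≤ b → f (σ ⟨$⟩ʳ a) ≲ f (σ ⟨$⟩ʳ b)
    monotone {zero} _ = fi₀≲ _
    monotone {suc a} {suc b} (s≤s a≤b) = sorted a≤b

IsInterval : ∀ {m} → (Fin m → Set) → Set
IsInterval P = ∀ a b c → a F.≤ b → b F.≤ c → P a → P c → P b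

resource₁⇒interval : (I : Instance) → IsResourceInstance 1 I → IsIntervalInstance I
resource₁⇒interval I (c , d , eligible⇔) with sortingPermutation QP.≤-totalPreorder (c zero)
... | π , sorted = π , λ j a b _ a≤b _ πa∈j _ →
  from (eligible⇔ (π ⟨$⟩ʳ b) j)
    λ { zero → QP.≤-trans (to (eligible⇔ (π ⟨$⟩ʳ a) j) πa∈j zero) (sorted a≤b) }

resource₁⇒nested : (I : Instance) → IsResourceInstance 1 I →
  ∀ j k → elig I j ⊆ elig I k ⊎ elig I k ⊆ elig I j
resource₁⇒nested I (_ , d , eligible⇔) j k = Sum.map shrink shrink (QP.≤-total (d zero k) (d zero j))
  where
  shrink : ∀ {j k} → d zero k Q.≤ d zero j → elig I j ⊆ elig I k
  shrink {j} {k} dk≤dj {i} i∈j =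
    from (eligible⇔ i k) λ { zero → QP.≤-trans dk≤dj (to (eligible⇔ i j) i∈j zero) }

singleton-isInterval : ∀ {m} (x : Fin m) → IsInterval (_∈ ⁅ x ⁆)
singleton-isInterval x a b c a≤b b≤c a∈ c∈ with x∈⁅y⁆⇒x≡y x a∈ | x∈⁅y⁆⇒x≡y x c∈
... | refl | refl = from x∈⁅y⁆⇔x≡y (FP.≤-antisym b≤c a≤b)

dedicated : ℕ → Instance
dedicated k = record { m = k ; n = k ; p = λ _ → 1ℚ ; elig = ⁅_⁆ }

dedicated-interval : ∀ k → IsIntervalInstance (dedicated k)
dedicated-interval k = P.id , λ j → singleton-isInterval j

dedicated-notResource₁ : ∀ k → ¬ IsResourceInstance 1 (dedicated (2 + k))
dedicated-notResource₁ k r with resource₁⇒nested (dedicated (2 + k)) r zero (suc zero)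
... | inj₁ 0⊆1 = x≢y⇒x∉⁅y⁆ {y = suc zero} (λ ()) (0⊆1 (x∈⁅x⁆ zero))
... | inj₂ 1⊆0 = x≢y⇒x∉⁅y⁆ {y = zero} (λ ()) (1⊆0 (x∈⁅x⁆ (suc zero)))

least : ∀ {m} {P : Fin m → Set} → Decidable P →
  (Σ (Fin m) λ y → P y × ∀ {x} → P x → y F.≤ x) ⊎ (∀ x → ¬ P x)
least {zero} P? = inj₂ λ ()
least {suc m} P? with P? zero
... | yes p0 = inj₁ (zero , p0 , λ _ → z≤n)
... | no ¬p0 with least (P? ∘ suc)
...   | inj₁ (y , py , y≤) = inj₁ (suc y , py , λ { {zero} p0 → contradiction p0 ¬p0 ; {suc x} px → s≤s (y≤ px) })
...   | inj₂ none = inj₂ λ { zero → ¬p0 ; (suc x) → none x }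

greatest : ∀ {m} {P : Fin m → Set} → Decidable P →
  (Σ (Fin m) λ z → P z × ∀ {x} → P x → x F.≤ z) ⊎ (∀ x → ¬ P x)
greatest {zero} P? = inj₂ λ ()
greatest {suc m} P? with greatest (P? ∘ suc)
... | inj₁ (z , pz , ≤z) = inj₁ (suc z , pz , λ { {zero} _ → z≤n ; {suc x} px → s≤s (≤z px) })
... | inj₂ none with P? zero
...   | yes p0 = inj₁ (zero , p0 , λ { {zero} _ → z≤n ; {suc x} px → contradiction px (none x) })
...   | no ¬p0 = inj₂ λ { zero → ¬p0 ; (suc x) → none x }

interval⇒bounds : ∀ {m} {P : Fin m → Set} → Decidable P → IsInterval P →
  Σ ℕ λ l → Σ ℕ λ u → ∀ b → P b ⇔ (l ℕ.≤ toℕ b × toℕ b ℕ.≤ u)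
interval⇒bounds {m} P? convex with least P? | greatest P?
... | inj₂ none | _ = m , 0 , λ b →
  -- the empty set: no position reaches the lower bound m
  mk⇔ (λ pb → contradiction pb (none b)) (λ (m≤b , _) → contradiction (FP.toℕ<n b) (ℕP.≤⇒≯ m≤b))
... | inj₁ (y , py , _) | inj₂ none = contradiction py (none y)
... | inj₁ (y , py , y≤) | inj₁ (z , pz , ≤z) = toℕ y , toℕ z , λ b →
  mk⇔ (λ pb → y≤ pb , ≤z pb) (λ (y≤b , b≤z) → convex y b z y≤b b≤z py pz)

capacity₂ : ℕ → Fin 2 → ℚ
capacity₂ x zero = fromℤ (+ x)
capacity₂ x (suc zero) = fromℤ (- + x)

demand₂ : ℕ → ℕ → Fin 2 → ℚ
demand₂ l u zero = fromℤ (+ l)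
demand₂ l u (suc zero) = fromℤ (- + u)

∈[l,u]⇔demand₂≤capacity₂ : ∀ {l u x} → (l ℕ.≤ x × x ℕ.≤ u) ⇔ (∀ r → demand₂ l u r Q.≤ capacity₂ x r)
∈[l,u]⇔demand₂≤capacity₂ = mk⇔
  (λ (l≤x , x≤u) → λ { zero → fromℤ-mono-≤ (ℤ.+≤+ l≤x)
                     ; (suc zero) → fromℤ-mono-≤ (ℤP.neg-mono-≤ (ℤ.+≤+ x≤u)) })
  (λ fits → ℤP.drop‿+≤+ (fromℤ-cancel-≤ (fits zero))
          , ℤP.drop‿+≤+ (ℤP.neg-cancel-≤ (fromℤ-cancel-≤ (fits (suc zero)))))

∈⇔∈-at-position : ∀ {m} (π : Permutation′ m) {S : Subset m} {i} → i ∈ S ⇔ π ⟨$⟩ʳ (π ⟨$⟩ˡ i) ∈ S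
∈⇔∈-at-position π {S} = mk⇔ (subst (_∈ S) (sym (inverseʳ π))) (subst (_∈ S) (inverseʳ π))

interval⇒resource₂ : (I : Instance) → IsIntervalInstance I → IsResourceInstance 2 I
interval⇒resource₂ I (π , convex) = capacity , demand , λ i j →
  ∈[l,u]⇔demand₂≤capacity₂ ⇔-∘ (proj₂ (proj₂ (bounds j)) (π ⟨$⟩ˡ i) ⇔-∘ ∈⇔∈-at-position π)
  where
  bounds : ∀ j → Σ ℕ λ l → Σ ℕ λ u → ∀ b → π ⟨$⟩ʳ b ∈ elig I j ⇔ (l ℕ.≤ toℕ b × toℕ b ℕ.≤ u)
  bounds j = interval⇒bounds (λ b → π ⟨$⟩ʳ b ∈? elig I j) (convex j)
  capacity : Fin 2 → Fin (m I) → ℚ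
  capacity r i = capacity₂ (toℕ (π ⟨$⟩ˡ i)) r
  demand : Fin 2 → Fin (n I) → ℚ
  demand r j = demand₂ (proj₁ (bounds j)) (proj₁ (proj₂ (bounds j))) r

Between : ∀ {m} → Fin m → Fin m → Fin m → Set
Between x y z = (x F.≤ y × y F.≤ z) ⊎ (z F.≤ y × y F.≤ x)

SameSide : ∀ {m} → Fin m → Fin m → Fin m → Set
SameSide q a b = (a F.≤ q × b F.≤ q) ⊎ (q F.≤ a × q F.≤ b)

interval-between : ∀ {m} {P : Fin m → Set} {x y z} → IsInterval P → Between x y z → P x → P z → P y
interval-between convex (inj₁ (x≤y , y≤z)) px pz = convex _ _ _ x≤y y≤z px pz
interval-between convex (inj₂ (z≤y , y≤x)) px pz = convex _ _ _ z≤y y≤x pz px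

sameSide⇒between : ∀ {m} {q a b : Fin m} → SameSide q a b → Between q a b ⊎ Between q b a
sameSide⇒between {a = a} {b} (inj₁ (a≤q , b≤q)) with FP.≤-total a b
... | inj₁ a≤b = inj₂ (inj₂ (a≤b , b≤q))
... | inj₂ b≤a = inj₁ (inj₂ (b≤a , a≤q))
sameSide⇒between {a = a} {b} (inj₂ (q≤a , q≤b)) with FP.≤-total a b
... | inj₁ a≤b = inj₁ (inj₁ (q≤a , a≤b))
... | inj₂ b≤a = inj₂ (inj₁ (q≤b , b≤a))

sameSide-pigeonhole : ∀ {m} (q a b c : Fin m) → SameSide q a b ⊎ SameSide q a c ⊎ SameSide q b c
sameSide-pigeonhole q a b c with FP.≤-total a q | FP.≤-total b q | FP.≤-total c q
... | inj₁ a≤q | inj₁ b≤q | _        = inj₁ (inj₁ (a≤q , b≤q))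
... | inj₂ q≤a | inj₂ q≤b | _        = inj₁ (inj₂ (q≤a , q≤b))
... | inj₁ a≤q | inj₂ _   | inj₁ c≤q = inj₂ (inj₁ (inj₁ (a≤q , c≤q)))
... | inj₂ q≤a | inj₁ _   | inj₂ q≤c = inj₂ (inj₁ (inj₂ (q≤a , q≤c)))
... | inj₁ _   | inj₂ q≤b | inj₂ q≤c = inj₂ (inj₂ (inj₂ (q≤b , q≤c)))
... | inj₂ _   | inj₁ b≤q | inj₁ c≤q = inj₂ (inj₂ (inj₁ (b≤q , c≤q)))

crossingIntervals⇒oppositeSides : ∀ {m} {P Q : Fin m → Set} {q a b} → IsInterval P → IsInterval Q →
  P q → Q q → P a → ¬ Q a → Q b → ¬ P b → ¬ SameSide q a b
crossingIntervals⇒oppositeSides convexP convexQ pq qq pa ¬qa qb ¬pb sameSide =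
  [ (λ q-a-b → ¬qa (interval-between convexQ q-a-b qq qb))
  , (λ q-b-a → ¬pb (interval-between convexP q-b-a pq pa)) ]′ (sameSide⇒between sameSide)

star : ℕ → Instance
star k = record { m = suc k ; n = k ; p = λ _ → 1ℚ ; elig = λ j → inside ∷ ⁅ j ⁆ }

star-leaf∈ : ∀ {k} (j : Fin k) → suc j ∈ elig (star k) j
star-leaf∈ j = there (x∈⁅x⁆ j)

star-leaf∉ : ∀ {k} {j l : Fin k} → j ≢ l → ¬ (suc j ∈ elig (star k) l)
star-leaf∉ j≢l = x≢y⇒x∉⁅y⁆ j≢l ∘ drop-there

star-resource₂ : ∀ k → IsResourceInstance 2 (star k)
star-resource₂ k = capacity , demand , eligible⇔
  where
  capacity : Fin 2 → Fin (suc k) → ℚ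
  capacity r zero = fromℤ (+ k)
  capacity r (suc i) = capacity₂ (toℕ i) r
  demand : Fin 2 → Fin k → ℚ
  demand r j = demand₂ (toℕ j) (toℕ j) r
  centre-fits : ∀ j r → demand r j Q.≤ fromℤ (+ k)
  centre-fits j zero = fromℤ-mono-≤ (ℤ.+≤+ (ℕP.<⇒≤ (FP.toℕ<n j)))
  centre-fits j (suc zero) = fromℤ-mono-≤ ℤP.neg-≤-pos
  ≡⇔≥×≤ : ∀ {i j : Fin k} → i ≡ j ⇔ (toℕ j ℕ.≤ toℕ i × toℕ i ℕ.≤ toℕ j)
  ≡⇔≥×≤ = mk⇔ (λ { refl → ℕP.≤-refl , ℕP.≤-refl }) (λ (j≤i , i≤j) → FP.≤-antisym i≤j j≤i)
  eligible⇔ : ∀ i j → i ∈ elig (star k) j ⇔ (∀ r → demand r j Q.≤ capacity r i)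
  eligible⇔ zero j = mk⇔ (λ _ → centre-fits j) (λ _ → here)
  eligible⇔ (suc i) j =
    ∈[l,u]⇔demand₂≤capacity₂ ⇔-∘ (≡⇔≥×≤ ⇔-∘ (x∈⁅y⁆⇔x≡y ⇔-∘ mk⇔ drop-there there))

star-notInterval : ∀ k → ¬ IsIntervalInstance (star (3 + k))
star-notInterval k (π , convex) =
  [ leavesApart j₀ j₁ (λ ()) , [ leavesApart j₀ j₂ (λ ()) , leavesApart j₁ j₂ (λ ()) ]′ ]′
    (sameSide-pigeonhole (position zero) (position (suc j₀)) (position (suc j₁)) (position (suc j₂)))
  where
  position : Fin (4 + k) → Fin (4 + k)
  position i = π ⟨$⟩ˡ i
  j₀ j₁ j₂ : Fin (3 + k)
  j₀ = zero
  j₁ = suc zero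
  j₂ = suc (suc zero)
  leavesApart : ∀ j l → j ≢ l → ¬ SameSide (position zero) (position (suc j)) (position (suc l))
  leavesApart j l j≢l = crossingIntervals⇒oppositeSides (convex j) (convex l)
    (to (∈⇔∈-at-position π) here) (to (∈⇔∈-at-position π) here)
    (to (∈⇔∈-at-position π) (star-leaf∈ j)) (star-leaf∉ j≢l ∘ from (∈⇔∈-at-position π))
    (to (∈⇔∈-at-position π) (star-leaf∈ l)) (star-leaf∉ (j≢l ∘ sym) ∘ from (∈⇔∈-at-position π))

mainTheorem6 : ((I : Instance) → IsResourceInstance 1 I → IsIntervalInstance I)
    × Σ Instance (λ I → IsIntervalInstance I × ¬ IsResourceInstance 1 I)
    × ((I : Instance) → IsIntervalInstance I → IsResourceInstance 2 I)
    × Σ Instance (λ I → IsResourceInstance 2 I × ¬ IsIntervalInstance I)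
mainTheorem6 =
    resource₁⇒interval
  , (dedicated 2 , dedicated-interval 2 , dedicated-notResource₁ 0)
  , interval⇒resource₂
  , (star 3 , star-resource₂ 3 , star-notInterval 0)
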